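{- Let $\Pi$ be a (not necessarily Desarguesian) projective plane of order $q$, and let $t$ be a nonnegative integer with $t\le q^2+q+1$. Then the following are equivalent: (i) there exist chambers $(P_1,\ell_1),\dots,(P_t,\ell_t)$ of $\Pi$ such that every chamber $(P,\ell)$ of $\Pi$ satisfies $P=P_i$ or $\ell=\ell_i$ for some $i\in\{1,\dots,t\}$ (equivalently, there is a proper $t$-coloring of $\Gamma_q$ each of whose color classes is contained in a chamber coclique); (ii) there exist a set $X$ of points and a set $Y$ of lines of $\Pi$ with $|X|=|Y|=q^2+q+1-t$ such that no point of $X$ is incident with a line of $Y$.
   Context: A chamber of a projective plane is an incident point-line pair $(P,\ell)$, $P\in\ell$. The Kneser graph $\Gamma_q$ on chambers of $\Pi$ has the chambers as vertices, with $(P_1,\ell_1)$ and $(P_2,\ell_2)$ adjacent iff $P_1\notin\ell_2$ and $P_2\notin\ell_1$. For a chamber $(P,\ell)$, the chamber coclique determined by it is the set of all chambers whose point is $P$ or whose line is $\ell$ (a coclique of $\Gamma_q$ of size $2q+1$). -}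

module Defs where

open import Data.Nat using (ℕ; suc; _+_; _*_; _∸_; _≤_)
open import Data.Fin using (Fin)
open import Data.Bool using (Bool; T)
open import Data.Product using (Σ; Σ-syntax; proj₁; proj₂; _×_; _,_; ∃-syntax)
open import Data.Sum using (_⊎_)
open import Relation.Nullary using (¬_)
open import Relation.Binary.PropositionalEquality using (_≡_)
open import Function.Bundles using (_↔_)
open import Function.Definitions using (Injective)

record IncidenceStructure : Set₁ where
  field
    Point : Set
    Line  : Set
    inc   : Point → Line → Bool

  _I_ : Point → Line → Set
  P I ℓ = T (inc P ℓ)

  PointsOn : Line → Set
  PointsOn ℓ = Σ Point (λ P → P I ℓ)

  Chamber : Set
  Chamber = Σ (Point × Line) (λ { (P , ℓ) → P I ℓ })


record IsProjectivePlane (Π : IncidenceStructure) : Set where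
  open IncidenceStructure Π
  field
    joinLine : ∀ (P Q : Point) → ¬ P ≡ Q →
      ∃[ ℓ ] ((P I ℓ × Q I ℓ) × (∀ m → P I m → Q I m → m ≡ ℓ))
    meetPoint : ∀ (ℓ m : Line) → ¬ ℓ ≡ m →
      ∃[ P ] ((P I ℓ × P I m) × (∀ Q → Q I ℓ → Q I m → Q ≡ P))
    quadrangle : Σ (Fin 4 → Point) λ f → Injective _≡_ _≡_ f ×
      (∀ (i j k : Fin 4) → ¬ i ≡ j → ¬ i ≡ k → ¬ j ≡ k →
        ¬ (∃[ ℓ ] (f i I ℓ × f j I ℓ × f k I ℓ)))

record ProjectivePlane (q : ℕ) : Set₁ where
  field
    struct   : IncidenceStructure
    isPP     : IsProjectivePlane struct
    order    : ∀ (ℓ : IncidenceStructure.Line struct) →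
      Fin (suc q) ↔ IncidenceStructure.PointsOn struct ℓ

open ProjectivePlane public

ChamberCover : ∀ {q} → ProjectivePlane q → ℕ → Set
ChamberCover Π t =
  Σ (Fin t → Chamber) λ c →
    ∀ (x : Chamber) → ∃[ i ]
      (proj₁ (proj₁ x) ≡ proj₁ (proj₁ (c i))
       ⊎ proj₂ (proj₁ x) ≡ proj₂ (proj₁ (c i)))
  where open IncidenceStructure (struct Π)

NonIncidentPair : ∀ {q} → ProjectivePlane q → ℕ → Set
NonIncidentPair Π k =
  Σ (Fin k → Point) λ X → Σ (Fin k → Line) λ Y →
    Injective _≡_ _≡_ X × Injective _≡_ _≡_ Y ×
    (∀ i j → ¬ (X i I Y j))
  where open IncidenceStructure (struct Π)

-- (i) ⇒ (ii): at most t points and t lines occur in the chambers (Pᵢ, ℓᵢ), so at least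
-- q² + q + 1 − t points and as many lines do not; a point and a line of these cannot be
-- incident, for the chamber they would form is not covered.
--
-- (ii) ⇒ (i): let L be the t points outside X and R the t lines outside Y. A chamber with
-- its point outside L has its point in X, hence its line outside Y, that is in R. So
-- chambers (P, ℓ) pairing L bijectively with R cover everything, and such a perfect
-- matching of the incidence graph between L and R exists by Hall's theorem. Hall's
-- condition |S| ≤ |N(S) ∩ R| for S ⊆ L comes from double counting flags: keeping the flags
-- through points of S on lines of R, and sending a flag (P, Yᵣ) to (Xᵣ, P Xᵣ), maps the
-- (q + 1) |S| flags through S injectively to the (q + 1) |N(S) ∩ R| flags on lines of
-- N(S) ∩ R. The counting identifies the points and the lines with Fin (q² + q + 1).
module Submission where

open import Data.Bool.Base using (Bool; T)
open import Data.Bool.Properties using (T?; T-≡; T-irrelevant)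
open import Data.Empty using (⊥; ⊥-elim; ⊥-elim-irr)
open import Data.Fin.Base using (Fin; zero; suc; inject≤; combine; remQuot; punchIn; punchOut; cast)
open import Data.Fin.Properties
  using (any?; injective⇒≤; inject≤-injective; suc-injective; combine-injective; combine-remQuot;
         punchIn-injective; punchInᵢ≢i; punchIn-punchOut; cast-involutive; +↔⊎; *↔×; 1↔⊤)
  renaming (_≟_ to _≟ᶠ_)
open import Data.Fin.Subset
  using (Subset; inside; outside; _∈_; _∉_; _⊆_; _⊂_; _∪_; _∩_; _─_; _-_; ∁; ⁅_⁆; ∣_∣; Nonempty; Empty)
import Data.Fin.Subset as Subset
open import Data.Fin.Subset.Induction using (⊂-wellFounded)
open import Data.Fin.Subset.Properties
  using (_∈?_; _⊆?_; nonempty?; anySubset?; Empty-unique; ∣⊥∣≡0; ∣⊤∣≡n; ∈⊤; ∣∁p∣≡n∸∣p∣;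
         x∈p∩q⁺; x∈p∩q⁻; x∈p∪q⁺; x∈p∪q⁻; x∈p∧x∉q⇒x∈p─q; x∈p∧x≢y⇒x∈p-y; x∈∁p⇒x∉p; x∉∁p⇒x∈p; x∉p⇒x∈∁p;
         x∈⁅x⁆; x∈⁅y⁆⇒x≡y; ∣⁅x⁆∣≡1; p⊆q⇒∣p∣≤∣q∣; p∩q⊆q; p─q⊆p; p∩q≢∅⇒p─q⊂p; x∈p⇒p-x⊂p; x∈p⇒∣p-x∣<∣p∣)
open import Data.Nat.Base using (ℕ; zero; suc; _+_; _*_; _∸_; _≤_; _<_; z≤n)
open import Data.Nat.Properties
  using (_≤?_; +-suc; +-comm; +-identityʳ; m≤m+n; ≤-reflexive; ≤-trans; ≤-antisym; ≰⇒>; <⇒≱; m<n⇒n≢0;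
         +-cancelʳ-≤; +-monoʳ-≤; *-cancelʳ-≤; ∸-monoʳ-≤; m∸[m∸n]≡n; module ≤-Reasoning)
open import Data.Product.Base using (Σ; ∃-syntax; _×_; _,_; proj₁; proj₂; uncurry; map₂)
open import Data.Product.Properties using (×-≡,≡→≡)
open import Data.Sum.Base using (_⊎_; inj₁; inj₂; [_,_]′)
open import Data.Sum.Function.Propositional using (_⊎-↔_)
open import Data.Unit.Base using (⊤; tt)
open import Data.Vec.Base using (_∷_; []; here; there; tabulate)
open import Data.Vec.Properties using (lookup∘tabulate; lookup⇒[]=; []=⇒lookup)
open import Function.Base using (_∘_)
open import Function.Bundles using (Equivalence; Injection; Inverse; _↔_; _⇔_; mk↔ₛ′; mk⇔)
open import Function.Definitions using (Injective)
open import Function.Properties.Inverse using (↔-trans; ↔-sym; ↔⇒↣)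
open import Induction.WellFounded using (Acc; acc)
open import Relation.Binary.Definitions using (DecidableEquality)
open import Relation.Binary.PropositionalEquality
  using (_≡_; _≢_; ≢-sym; refl; sym; trans; cong; cong₂; subst; module ≡-Reasoning)
open import Relation.Nullary.Decidable using (Dec; yes; no; ⌊_⌋; toWitness; fromWitness; _×-dec_; map′)
open import Relation.Nullary.Negation using (¬_; contradiction)
open import Relation.Unary using (Pred; Decidable)

open import Defs

private variable
  n m k : ℕ
  p q : Subset n

toSubset : ∀ {ℓ} {P : Pred (Fin n) ℓ} → Decidable P → Subset n
toSubset P? = tabulate (⌊_⌋ ∘ P?)

module _ {ℓ} {P : Pred (Fin n) ℓ} (P? : Decidable P) where

  ∈-toSubset⁺ : ∀ {i} → P i → i ∈ toSubset P?
  ∈-toSubset⁺ {i} Pi = lookup⇒[]= i _ (trans (lookup∘tabulate _ i) (Equivalence.to T-≡ (fromWitness Pi)))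

  ∈-toSubset⁻ : ∀ {i} → i ∈ toSubset P? → P i
  ∈-toSubset⁻ {i} i∈ = toWitness (Equivalence.from T-≡ (trans (sym (lookup∘tabulate _ i)) ([]=⇒lookup i∈)))

x∈p─q⁻ : ∀ {i : Fin n} → i ∈ p ─ q → i ∈ p × i ∉ q
x∈p─q⁻ {p = inside ∷ p} {outside ∷ q} here = here , λ ()
x∈p─q⁻ {p = outside ∷ p} {outside ∷ q} {zero} ()
x∈p─q⁻ {p = _ ∷ p} {inside ∷ q} {zero} ()
x∈p─q⁻ {p = _ ∷ p} {_ ∷ q} (there i∈) with x∈p─q⁻ {p = p} {q} i∈
... | i∈p , i∉q = there i∈p , λ { (there i∈q) → i∉q i∈q }

∣p∪q∣+∣p∩q∣≡∣p∣+∣q∣ : ∀ (p q : Subset n) → ∣ p ∪ q ∣ + ∣ p ∩ q ∣ ≡ ∣ p ∣ + ∣ q ∣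
∣p∪q∣+∣p∩q∣≡∣p∣+∣q∣ [] [] = refl
∣p∪q∣+∣p∩q∣≡∣p∣+∣q∣ (outside ∷ p) (outside ∷ q) = ∣p∪q∣+∣p∩q∣≡∣p∣+∣q∣ p q
∣p∪q∣+∣p∩q∣≡∣p∣+∣q∣ (inside ∷ p) (outside ∷ q) = cong suc (∣p∪q∣+∣p∩q∣≡∣p∣+∣q∣ p q)
∣p∪q∣+∣p∩q∣≡∣p∣+∣q∣ (outside ∷ p) (inside ∷ q) =
  trans (cong suc (∣p∪q∣+∣p∩q∣≡∣p∣+∣q∣ p q)) (sym (+-suc ∣ p ∣ ∣ q ∣))
∣p∪q∣+∣p∩q∣≡∣p∣+∣q∣ (inside ∷ p) (inside ∷ q) = cong suc (begin
  ∣ p ∪ q ∣ + suc ∣ p ∩ q ∣      ≡⟨ +-suc ∣ p ∪ q ∣ ∣ p ∩ q ∣ ⟩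
  suc (∣ p ∪ q ∣ + ∣ p ∩ q ∣)    ≡⟨ cong suc (∣p∪q∣+∣p∩q∣≡∣p∣+∣q∣ p q) ⟩
  suc (∣ p ∣ + ∣ q ∣)            ≡⟨ +-suc ∣ p ∣ ∣ q ∣ ⟨
  ∣ p ∣ + suc ∣ q ∣              ∎)
  where open ≡-Reasoning

∣p∪q∣≤∣p∣+∣q∣ : ∀ (p q : Subset n) → ∣ p ∪ q ∣ ≤ ∣ p ∣ + ∣ q ∣
∣p∪q∣≤∣p∣+∣q∣ p q = ≤-trans (m≤m+n ∣ p ∪ q ∣ ∣ p ∩ q ∣) (≤-reflexive (∣p∪q∣+∣p∩q∣≡∣p∣+∣q∣ p q))

Empty⇒∣p∣≡0 : Empty p → ∣ p ∣ ≡ 0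
Empty⇒∣p∣≡0 {n} empty = trans (cong ∣_∣ (Empty-unique empty)) (∣⊥∣≡0 n)

Empty[p∩q]⇒∣p∪q∣≡∣p∣+∣q∣ : ∀ (p q : Subset n) → Empty (p ∩ q) → ∣ p ∪ q ∣ ≡ ∣ p ∣ + ∣ q ∣
Empty[p∩q]⇒∣p∪q∣≡∣p∣+∣q∣ p q disjoint = begin
  ∣ p ∪ q ∣                ≡⟨ +-identityʳ _ ⟨
  ∣ p ∪ q ∣ + 0            ≡⟨ cong (∣ p ∪ q ∣ +_) (Empty⇒∣p∣≡0 disjoint) ⟨
  ∣ p ∪ q ∣ + ∣ p ∩ q ∣    ≡⟨ ∣p∪q∣+∣p∩q∣≡∣p∣+∣q∣ p q ⟩
  ∣ p ∣ + ∣ q ∣            ∎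
  where open ≡-Reasoning

enum : (p : Subset n) → Fin ∣ p ∣ → Fin n
enum (inside ∷ p) zero = zero
enum (inside ∷ p) (suc r) = suc (enum p r)
enum (outside ∷ p) r = suc (enum p r)

enum-∈ : ∀ (p : Subset n) r → enum p r ∈ p
enum-∈ (inside ∷ p) zero = here
enum-∈ (inside ∷ p) (suc r) = there (enum-∈ p r)
enum-∈ (outside ∷ p) r = there (enum-∈ p r)

enum-injective : ∀ (p : Subset n) → Injective _≡_ _≡_ (enum p)
enum-injective (inside ∷ p) {zero} {zero} _ = refl
enum-injective (inside ∷ p) {suc r} {suc r'} e = cong suc (enum-injective p (suc-injective e))
enum-injective (outside ∷ p) e = enum-injective p (suc-injective e)

index : ∀ {i : Fin n} → i ∈ p → Fin ∣ p ∣
index {p = inside ∷ p} here = zero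
index {p = inside ∷ p} (there i∈p) = suc (index i∈p)
index {p = outside ∷ p} (there i∈p) = index i∈p

enum-index : ∀ {i : Fin n} (i∈p : i ∈ p) → enum p (index i∈p) ≡ i
enum-index {p = inside ∷ p} here = refl
enum-index {p = inside ∷ p} (there i∈p) = cong suc (enum-index i∈p)
enum-index {p = outside ∷ p} (there i∈p) = cong suc (enum-index i∈p)

injection⇒∣p∣≤∣q∣ : ∀ {p : Subset n} {q : Subset m} (f : ∀ i → i ∈ p → Fin m) →
  (∀ {i} (i∈p : i ∈ p) → f i i∈p ∈ q) →
  (∀ {i j} (i∈p : i ∈ p) (j∈p : j ∈ p) → f i i∈p ≡ f j j∈p → i ≡ j) →
  ∣ p ∣ ≤ ∣ q ∣
injection⇒∣p∣≤∣q∣ {p = p} {q} f f∈q f-injective = injective⇒≤ g-injective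
  where
  g : Fin ∣ p ∣ → Fin ∣ q ∣
  g r = index (f∈q (enum-∈ p r))

  g-injective : Injective _≡_ _≡_ g
  g-injective e = enum-injective p
    (f-injective _ _ (trans (sym (enum-index _)) (trans (cong (enum q) e) (enum-index _))))

injection⇒∣p∣*a≤∣q∣*b : ∀ {p : Subset n} {q : Subset m} {a b}
  (f : ∀ i → i ∈ p → Fin a → Fin m × Fin b) →
  (∀ {i} (i∈p : i ∈ p) c → proj₁ (f i i∈p c) ∈ q) →
  (∀ {i j} (i∈p : i ∈ p) (j∈p : j ∈ p) c d → f i i∈p c ≡ f j j∈p d → i ≡ j × c ≡ d) →
  ∣ p ∣ * a ≤ ∣ q ∣ * b
injection⇒∣p∣*a≤∣q∣*b {p = p} {q} {a} f f∈q f-injective = injective⇒≤ g-injective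
  where
  h : Fin ∣ p ∣ → Fin a → Fin (∣ q ∣ * _)
  h r c = combine (index (f∈q (enum-∈ p r) c)) (proj₂ (f _ (enum-∈ p r) c))

  h-injective : ∀ r c r′ c′ → h r c ≡ h r′ c′ → (r , c) ≡ (r′ , c′)
  h-injective r c r′ c′ e with combine-injective _ _ _ _ e
  ... | e₁ , e₂ with f-injective _ _ c c′
                       (×-≡,≡→≡ (trans (sym (enum-index _)) (trans (cong (enum q) e₁) (enum-index _)) , e₂))
  ...   | er , refl = cong (_, c) (enum-injective p er)

  g : Fin (∣ p ∣ * a) → Fin (∣ q ∣ * _)
  g = uncurry h ∘ remQuot {∣ p ∣} a

  g-injective : Injective _≡_ _≡_ g
  g-injective {x} {y} e = begin
    x                                        ≡⟨ combine-remQuot {∣ p ∣} a x ⟨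
    uncurry combine (remQuot {∣ p ∣} a x)    ≡⟨ cong (uncurry combine) (h-injective _ _ _ _ e) ⟩
    uncurry combine (remQuot {∣ p ∣} a y)    ≡⟨ combine-remQuot {∣ p ∣} a y ⟩
    y                                        ∎
    where open ≡-Reasoning

image : (Fin k → Fin n) → Subset n
image g = toSubset (λ i → any? (λ r → g r ≟ᶠ i))

module _ (g : Fin k → Fin n) where

  ∈-image⁺ : ∀ r → g r ∈ image g
  ∈-image⁺ r = ∈-toSubset⁺ _ (r , refl)

  ∈-image⁻ : ∀ {i} → i ∈ image g → ∃[ r ] g r ≡ i
  ∈-image⁻ = ∈-toSubset⁻ _

  ∣image∣≤ : ∣ image g ∣ ≤ k
  ∣image∣≤ = ≤-trans
    (injection⇒∣p∣≤∣q∣ (λ i i∈ → proj₁ (∈-image⁻ i∈)) (λ _ → ∈⊤)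
      (λ i∈ j∈ e → trans (sym (proj₂ (∈-image⁻ i∈))) (trans (cong g e) (proj₂ (∈-image⁻ j∈)))))
    (≤-reflexive (∣⊤∣≡n k))

  ∣image∣≡ : Injective _≡_ _≡_ g → ∣ image g ∣ ≡ k
  ∣image∣≡ g-injective = ≤-antisym ∣image∣≤ (≤-trans (≤-reflexive (sym (∣⊤∣≡n k)))
    (injection⇒∣p∣≤∣q∣ {p = Subset.⊤} (λ r _ → g r) (λ {r} _ → ∈-image⁺ r) (λ _ _ → g-injective)))

0<∣p∣⇒Nonempty : 0 < ∣ p ∣ → Nonempty p
0<∣p∣⇒Nonempty {p = p} 0<∣p∣ with nonempty? p
... | yes p-nonempty = p-nonempty
... | no p-empty = contradiction (Empty⇒∣p∣≡0 p-empty) (m<n⇒n≢0 0<∣p∣)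

p∩q⊆p∩[q─r]∪r : ∀ (p q r : Subset n) → p ∩ q ⊆ p ∩ (q ─ r) ∪ r
p∩q⊆p∩[q─r]∪r p q r {i} i∈p∩q with i ∈? r
... | yes i∈r = x∈p∪q⁺ (inj₂ i∈r)
... | no i∉r = x∈p∪q⁺ (inj₁ (x∈p∩q⁺ (proj₁ i∈p×q , x∈p∧x∉q⇒x∈p─q (proj₂ i∈p×q) i∉r)))
  where i∈p×q = x∈p∩q⁻ p q i∈p∩q

module Hall {ℓ} {E : Fin n → Fin m → Set ℓ} (E? : ∀ i j → Dec (E i j)) where

  neighbours : Subset n → Subset m
  neighbours S = toSubset (λ j → any? (λ i → (i ∈? S) ×-dec E? i j))

  ∈-neighbours⁺ : ∀ {S i j} → i ∈ S → E i j → j ∈ neighbours S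
  ∈-neighbours⁺ {i = i} i∈S e = ∈-toSubset⁺ _ (i , i∈S , e)

  ∈-neighbours⁻ : ∀ {S j} → j ∈ neighbours S → ∃[ i ] i ∈ S × E i j
  ∈-neighbours⁻ = ∈-toSubset⁻ _

  neighbours-mono : ∀ {S T} → S ⊆ T → neighbours S ⊆ neighbours T
  neighbours-mono S⊆T j∈ with ∈-neighbours⁻ j∈
  ... | i , i∈S , e = ∈-neighbours⁺ (S⊆T i∈S) e

  HallCondition : Subset n → Subset m → Set
  HallCondition L R = ∀ {S} → S ⊆ L → ∣ S ∣ ≤ ∣ neighbours S ∩ R ∣

  -- Only defined on L, as Fin m may be empty; the membership proof is irrelevant, so
  -- mate i does not depend on it.
  record Matching (L : Subset n) (R : Subset m) : Set ℓ where
    field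
      mate : ∀ i → .(i ∈ L) → Fin m
      mate-∈ : ∀ {i} (i∈L : i ∈ L) → mate i i∈L ∈ R
      mate-adjacent : ∀ {i} (i∈L : i ∈ L) → E i (mate i i∈L)
      mate-injective : ∀ {i j} (i∈L : i ∈ L) (j∈L : j ∈ L) → mate i i∈L ≡ mate j j∈L → i ≡ j

  open Matching

  emptyMatching : ∀ {L R} → Empty L → Matching L R
  emptyMatching L-empty = record
    { mate = λ i i∈L → ⊥-elim-irr (L-empty (i , i∈L))
    ; mate-∈ = λ i∈L → ⊥-elim (L-empty (_ , i∈L))
    ; mate-adjacent = λ i∈L → ⊥-elim (L-empty (_ , i∈L))
    ; mate-injective = λ i∈L _ _ → ⊥-elim (L-empty (_ , i∈L))
    }

  edgeMatching : ∀ {i j} → E i j → Matching ⁅ i ⁆ ⁅ j ⁆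
  edgeMatching {i} {j} e = record
    { mate = λ _ _ → j
    ; mate-∈ = λ _ → x∈⁅x⁆ j
    ; mate-adjacent = λ k∈⁅i⁆ → subst (λ k → E k j) (sym (x∈⁅y⁆⇒x≡y i k∈⁅i⁆)) e
    ; mate-injective = λ k∈⁅i⁆ k'∈⁅i⁆ _ → trans (x∈⁅y⁆⇒x≡y i k∈⁅i⁆) (sym (x∈⁅y⁆⇒x≡y i k'∈⁅i⁆))
    }

  matching-split : ∀ {L R S r} → S ⊆ L → r ⊆ R →
    Matching S r → Matching (L ─ S) (R ─ r) → Matching L R
  matching-split {L} {R} {S} {r} S⊆L r⊆R M₁ M₂ = record
    { mate = mate′ ; mate-∈ = mate′-∈ ; mate-adjacent = mate′-adjacent ; mate-injective = mate′-injective }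
    where
    mate′ : ∀ i → .(i ∈ L) → Fin m
    mate′ i i∈L with i ∈? S
    ... | yes i∈S = mate M₁ i i∈S
    ... | no i∉S = mate M₂ i (x∈p∧x∉q⇒x∈p─q i∈L i∉S)

    mate′-∈ : ∀ {i} (i∈L : i ∈ L) → mate′ i i∈L ∈ R
    mate′-∈ {i} i∈L with i ∈? S
    ... | yes i∈S = r⊆R (mate-∈ M₁ i∈S)
    ... | no i∉S = p─q⊆p R r (mate-∈ M₂ (x∈p∧x∉q⇒x∈p─q i∈L i∉S))

    mate′-adjacent : ∀ {i} (i∈L : i ∈ L) → E i (mate′ i i∈L)
    mate′-adjacent {i} i∈L with i ∈? S
    ... | yes i∈S = mate-adjacent M₁ i∈S
    ... | no i∉S = mate-adjacent M₂ (x∈p∧x∉q⇒x∈p─q i∈L i∉S)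

    mate′-injective : ∀ {i j} (i∈L : i ∈ L) (j∈L : j ∈ L) → mate′ i i∈L ≡ mate′ j j∈L → i ≡ j
    mate′-injective {i} {j} i∈L j∈L e with i ∈? S | j ∈? S
    ... | yes i∈S | yes j∈S = mate-injective M₁ i∈S j∈S e
    ... | no i∉S | no j∉S = mate-injective M₂ (x∈p∧x∉q⇒x∈p─q i∈L i∉S) (x∈p∧x∉q⇒x∈p─q j∈L j∉S) e
    ... | yes i∈S | no j∉S = contradiction (subst (_∈ r) e (mate-∈ M₁ i∈S))
                                (proj₂ (x∈p─q⁻ (mate-∈ M₂ (x∈p∧x∉q⇒x∈p─q j∈L j∉S))))
    ... | no i∉S | yes j∈S = contradiction (subst (_∈ r) (sym e) (mate-∈ M₁ j∈S))
                                (proj₂ (x∈p─q⁻ (mate-∈ M₂ (x∈p∧x∉q⇒x∈p─q i∈L i∉S))))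

  HallCondition-restrict : ∀ {L R S} → S ⊆ L → HallCondition L R → HallCondition S (neighbours S ∩ R)
  HallCondition-restrict {R = R} {S} S⊆L hallL {T} T⊆S = ≤-trans (hallL (S⊆L ∘ T⊆S)) (p⊆q⇒∣p∣≤∣q∣ shrink)
    where
    shrink : neighbours T ∩ R ⊆ neighbours T ∩ (neighbours S ∩ R)
    shrink j∈ with x∈p∩q⁻ (neighbours T) R j∈
    ... | j∈N[T] , j∈R = x∈p∩q⁺ (j∈N[T] , x∈p∩q⁺ (neighbours-mono T⊆S j∈N[T] , j∈R))

  -- Hall's condition for T ∪ S, less the at most |S| neighbours of S, gives it for T.
  HallCondition-removeTight : ∀ {L R S} → S ⊆ L → ∣ neighbours S ∩ R ∣ ≤ ∣ S ∣ →
    HallCondition L R → HallCondition (L ─ S) (R ─ (neighbours S ∩ R))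
  HallCondition-removeTight {L} {R} {S} S⊆L tight hallL {T} T⊆L─S = +-cancelʳ-≤ ∣ S ∣ ∣ T ∣ _ (begin
    ∣ T ∣ + ∣ S ∣                           ≡⟨ Empty[p∩q]⇒∣p∪q∣≡∣p∣+∣q∣ T S disjoint ⟨
    ∣ T ∪ S ∣                               ≤⟨ hallL T∪S⊆L ⟩
    ∣ neighbours (T ∪ S) ∩ R ∣              ≤⟨ p⊆q⇒∣p∣≤∣q∣ split ⟩
    ∣ neighbours T ∩ (R ─ r) ∪ r ∣          ≤⟨ ∣p∪q∣≤∣p∣+∣q∣ (neighbours T ∩ (R ─ r)) r ⟩
    ∣ neighbours T ∩ (R ─ r) ∣ + ∣ r ∣      ≤⟨ +-monoʳ-≤ ∣ neighbours T ∩ (R ─ r) ∣ tight ⟩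
    ∣ neighbours T ∩ (R ─ r) ∣ + ∣ S ∣      ∎)
    where
    open ≤-Reasoning
    r : Subset m
    r = neighbours S ∩ R

    disjoint : Empty (T ∩ S)
    disjoint (i , i∈T∩S) with x∈p∩q⁻ T S i∈T∩S
    ... | i∈T , i∈S = proj₂ (x∈p─q⁻ (T⊆L─S i∈T)) i∈S

    T∪S⊆L : T ∪ S ⊆ L
    T∪S⊆L i∈ with x∈p∪q⁻ T S i∈
    ... | inj₁ i∈T = proj₁ (x∈p─q⁻ (T⊆L─S i∈T))
    ... | inj₂ i∈S = S⊆L i∈S

    split : neighbours (T ∪ S) ∩ R ⊆ neighbours T ∩ (R ─ r) ∪ r
    split {j} j∈ with x∈p∩q⁻ (neighbours (T ∪ S)) R j∈ | j ∈? r
    ... | _ , _ | yes j∈r = x∈p∪q⁺ (inj₂ j∈r)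
    ... | j∈N , j∈R | no j∉r with ∈-neighbours⁻ j∈N
    ...   | i , i∈T∪S , e with x∈p∪q⁻ T S i∈T∪S
    ...     | inj₁ i∈T = x∈p∪q⁺ (inj₁ (x∈p∩q⁺ (∈-neighbours⁺ i∈T e , x∈p∧x∉q⇒x∈p─q j∈R j∉r)))
    ...     | inj₂ i∈S = contradiction (x∈p∩q⁺ (∈-neighbours⁺ i∈S e , j∈R)) j∉r

  HallCondition-surplus : ∀ {L R} (j : Fin m) →
    (∀ {T} → T ⊆ L → Nonempty T → ∣ T ∣ < ∣ neighbours T ∩ R ∣) → HallCondition L (R - j)
  HallCondition-surplus {L} {R} j surplus {T} T⊆L with nonempty? T
  ... | no T-empty = ≤-trans (≤-reflexive (Empty⇒∣p∣≡0 T-empty)) z≤n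
  ... | yes T-nonempty = +-cancelʳ-≤ 1 ∣ T ∣ _ (begin
    ∣ T ∣ + 1                               ≡⟨ +-comm ∣ T ∣ 1 ⟩
    suc ∣ T ∣                               ≤⟨ surplus T⊆L T-nonempty ⟩
    ∣ neighbours T ∩ R ∣                    ≤⟨ p⊆q⇒∣p∣≤∣q∣ (p∩q⊆p∩[q─r]∪r (neighbours T) R ⁅ j ⁆) ⟩
    ∣ neighbours T ∩ (R - j) ∪ ⁅ j ⁆ ∣      ≤⟨ ∣p∪q∣≤∣p∣+∣q∣ (neighbours T ∩ (R - j)) ⁅ j ⁆ ⟩
    ∣ neighbours T ∩ (R - j) ∣ + ∣ ⁅ j ⁆ ∣  ≡⟨ cong (∣ neighbours T ∩ (R - j) ∣ +_) (∣⁅x⁆∣≡1 j) ⟩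
    ∣ neighbours T ∩ (R - j) ∣ + 1          ∎)
    where open ≤-Reasoning

  -- Halmos–Vaughan induction: either some nonempty S ⊆ L - i is tight, and we split
  -- along S, or every such S has a surplus, and we match i to any neighbour j.
  hall-acc : ∀ {L R} → Acc _⊂_ L → HallCondition L R → Matching L R
  hall-acc {L} {R} (acc rec) hallL with nonempty? L
  ... | no L-empty = emptyMatching L-empty
  ... | yes (i , i∈L)
    with anySubset? (λ S → (S ⊆? L - i) ×-dec nonempty? S ×-dec (∣ neighbours S ∩ R ∣ ≤? ∣ S ∣))
  ...   | yes (S , S⊆L-i , (k , k∈S) , tight) =
    matching-split S⊆L (p∩q⊆q (neighbours S) R)
      (hall-acc (rec S⊂L) (HallCondition-restrict S⊆L hallL))
      (hall-acc (rec L─S⊂L) (HallCondition-removeTight S⊆L tight hallL))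
    where
    S⊆L : S ⊆ L
    S⊆L = p─q⊆p L ⁅ i ⁆ ∘ S⊆L-i

    S⊂L : S ⊂ L
    S⊂L = S⊆L , i , i∈L , λ i∈S → proj₂ (x∈p─q⁻ (S⊆L-i i∈S)) (x∈⁅x⁆ i)

    L─S⊂L : L ─ S ⊂ L
    L─S⊂L = p∩q≢∅⇒p─q⊂p L S (k , x∈p∩q⁺ (S⊆L k∈S , k∈S))
  ...   | no noTight =
    matching-split ⁅i⁆⊆L ⁅j⁆⊆R (edgeMatching e)
      (hall-acc (rec (x∈p⇒p-x⊂p i∈L)) (HallCondition-surplus j surplus))
    where
    ⁅i⁆⊆L : ⁅ i ⁆ ⊆ L
    ⁅i⁆⊆L k∈⁅i⁆ = subst (_∈ L) (sym (x∈⁅y⁆⇒x≡y i k∈⁅i⁆)) i∈L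

    neighbour : Nonempty (neighbours ⁅ i ⁆ ∩ R)
    neighbour = 0<∣p∣⇒Nonempty (≤-trans (≤-reflexive (sym (∣⁅x⁆∣≡1 i))) (hallL ⁅i⁆⊆L))

    j : Fin m
    j = proj₁ neighbour

    j∈N×R = x∈p∩q⁻ (neighbours ⁅ i ⁆) R (proj₂ neighbour)

    ⁅j⁆⊆R : ⁅ j ⁆ ⊆ R
    ⁅j⁆⊆R k∈⁅j⁆ = subst (_∈ R) (sym (x∈⁅y⁆⇒x≡y j k∈⁅j⁆)) (proj₂ j∈N×R)

    e : E i j
    e with ∈-neighbours⁻ (proj₁ j∈N×R)
    ... | i′ , i′∈⁅i⁆ , e′ = subst (λ k → E k j) (x∈⁅y⁆⇒x≡y i i′∈⁅i⁆) e′

    surplus : ∀ {T} → T ⊆ L - i → Nonempty T → ∣ T ∣ < ∣ neighbours T ∩ R ∣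
    surplus T⊆L-i T-nonempty = ≰⇒> (λ tight → noTight (_ , T⊆L-i , T-nonempty , tight))

  hall : ∀ {L R} → HallCondition L R → Matching L R
  hall {L} = hall-acc (⊂-wellFounded L)

  mate-surjective : ∀ {L R} → ∣ R ∣ ≤ ∣ L ∣ → (M : Matching L R) →
    ∀ {j} → j ∈ R → ∃[ i ] Σ (i ∈ L) λ i∈L → mate M i i∈L ≡ j
  mate-surjective {L} {R} ∣R∣≤∣L∣ M {j} j∈R with any? mated?
    where
    mated? : ∀ i → Dec (Σ (i ∈ L) λ i∈L → mate M i i∈L ≡ j)
    mated? i with i ∈? L
    ... | yes i∈L = map′ (i∈L ,_) proj₂ (mate M i i∈L ≟ᶠ j)
    ... | no i∉L = no (i∉L ∘ proj₁)
  ... | yes found = found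
  ... | no notFound = contradiction (≤-trans ∣R∣≤∣L∣ ∣L∣≤∣R-j∣) (<⇒≱ (x∈p⇒∣p-x∣<∣p∣ j∈R))
    where
    ∣L∣≤∣R-j∣ : ∣ L ∣ ≤ ∣ R - j ∣
    ∣L∣≤∣R-j∣ = injection⇒∣p∣≤∣q∣ (λ i i∈L → mate M i i∈L)
      (λ i∈L → x∈p∧x≢y⇒x∈p-y (mate-∈ M i∈L) (λ e → notFound (_ , i∈L , e)))
      (mate-injective M)

Σ-T-≡ : ∀ {A : Set} {f : A → Bool} {x y : Σ A (T ∘ f)} → proj₁ x ≡ proj₁ y → x ≡ y
Σ-T-≡ {x = a , t} {.a , t′} refl = cong (a ,_) (T-irrelevant t t′)

dualStructure : IncidenceStructure → IncidenceStructure
dualStructure S = record { Point = Line ; Line = Point ; inc = λ ℓ P → inc P ℓ }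
  where open IncidenceStructure S

record JoinsAndMeets (S : IncidenceStructure) : Set where
  open IncidenceStructure S
  field
    joinLine : ∀ (P Q : Point) → P ≢ Q →
      ∃[ ℓ ] ((P I ℓ × Q I ℓ) × (∀ m → P I m → Q I m → m ≡ ℓ))
    meetPoint : ∀ (ℓ m : Line) → ℓ ≢ m →
      ∃[ P ] ((P I ℓ × P I m) × (∀ Q → Q I ℓ → Q I m → Q ≡ P))

  join : ∀ P Q → P ≢ Q → Line
  join P Q P≢Q = proj₁ (joinLine P Q P≢Q)

  join-I₁ : ∀ {P Q} (P≢Q : P ≢ Q) → P I join P Q P≢Q
  join-I₁ {P} {Q} P≢Q = proj₁ (proj₁ (proj₂ (joinLine P Q P≢Q)))

  join-I₂ : ∀ {P Q} (P≢Q : P ≢ Q) → Q I join P Q P≢Q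
  join-I₂ {P} {Q} P≢Q = proj₂ (proj₁ (proj₂ (joinLine P Q P≢Q)))

  line-unique : ∀ {P Q ℓ m} → P ≢ Q → P I ℓ → Q I ℓ → P I m → Q I m → ℓ ≡ m
  line-unique {P} {Q} {ℓ} {m} P≢Q P∈ℓ Q∈ℓ P∈m Q∈m =
    trans (proj₂ (proj₂ (joinLine P Q P≢Q)) ℓ P∈ℓ Q∈ℓ) (sym (proj₂ (proj₂ (joinLine P Q P≢Q)) m P∈m Q∈m))

  meet : ∀ ℓ m → ℓ ≢ m → Point
  meet ℓ m ℓ≢m = proj₁ (meetPoint ℓ m ℓ≢m)

  meet-I₁ : ∀ {ℓ m} (ℓ≢m : ℓ ≢ m) → meet ℓ m ℓ≢m I ℓ
  meet-I₁ {ℓ} {m} ℓ≢m = proj₁ (proj₁ (proj₂ (meetPoint ℓ m ℓ≢m)))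

  meet-I₂ : ∀ {ℓ m} (ℓ≢m : ℓ ≢ m) → meet ℓ m ℓ≢m I m
  meet-I₂ {ℓ} {m} ℓ≢m = proj₂ (proj₁ (proj₂ (meetPoint ℓ m ℓ≢m)))

  point-unique : ∀ {P Q ℓ m} → ℓ ≢ m → P I ℓ → P I m → Q I ℓ → Q I m → P ≡ Q
  point-unique {P} {Q} {ℓ} {m} ℓ≢m P∈ℓ P∈m Q∈ℓ Q∈m =
    trans (proj₂ (proj₂ (meetPoint ℓ m ℓ≢m)) P P∈ℓ P∈m) (sym (proj₂ (proj₂ (meetPoint ℓ m ℓ≢m)) Q Q∈ℓ Q∈m))

  P∈ℓ∧Q∉ℓ⇒P≢Q : ∀ {P Q ℓ} → P I ℓ → ¬ Q I ℓ → P ≢ Q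
  P∈ℓ∧Q∉ℓ⇒P≢Q P∈ℓ Q∉ℓ refl = Q∉ℓ P∈ℓ

  P∈ℓ∧P∉m⇒ℓ≢m : ∀ {P ℓ m} → P I ℓ → ¬ P I m → ℓ ≢ m
  P∈ℓ∧P∉m⇒ℓ≢m P∈ℓ P∉m refl = P∉m P∈ℓ

  pencil↔ : ∀ {P m} → ¬ P I m → PointsOn m ↔ Σ Line (P I_)
  pencil↔ {P} {m} P∉m = mk↔ₛ′ to from to-from from-to
    where
    P≢ : ∀ {A} → A I m → P ≢ A
    P≢ A∈m = ≢-sym (P∈ℓ∧Q∉ℓ⇒P≢Q A∈m P∉m)

    ≢m : ∀ {ℓ} → P I ℓ → ℓ ≢ m
    ≢m P∈ℓ = P∈ℓ∧P∉m⇒ℓ≢m P∈ℓ P∉m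

    to : PointsOn m → Σ Line (P I_)
    to (A , A∈m) = join P A (P≢ A∈m) , join-I₁ _

    from : Σ Line (P I_) → PointsOn m
    from (ℓ , P∈ℓ) = meet ℓ m (≢m P∈ℓ) , meet-I₂ _

    to-from : ∀ x → to (from x) ≡ x
    to-from (ℓ , P∈ℓ) = Σ-T-≡ (line-unique (P≢ (meet-I₂ _)) (join-I₁ _) (join-I₂ _) P∈ℓ (meet-I₁ _))

    from-to : ∀ x → from (to x) ≡ x
    from-to (A , A∈m) = Σ-T-≡ (point-unique (≢m (join-I₁ _)) (meet-I₁ _) (meet-I₂ _) (join-I₂ _) A∈m)

module Positions {q} (S : IncidenceStructure)
  (pointsOn : ∀ ℓ → Fin (suc q) ↔ IncidenceStructure.PointsOn S ℓ) where
  open IncidenceStructure S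

  pointAt : Line → Fin (suc q) → Point
  pointAt ℓ k = proj₁ (Inverse.to (pointsOn ℓ) k)

  pointAt-I : ∀ ℓ k → pointAt ℓ k I ℓ
  pointAt-I ℓ k = proj₂ (Inverse.to (pointsOn ℓ) k)

  position : ∀ {P ℓ} → P I ℓ → Fin (suc q)
  position {P} {ℓ} P∈ℓ = Inverse.from (pointsOn ℓ) (P , P∈ℓ)

  pointAt-position : ∀ {P ℓ} (P∈ℓ : P I ℓ) → pointAt ℓ (position P∈ℓ) ≡ P
  pointAt-position {P} {ℓ} P∈ℓ = cong proj₁ (Inverse.strictlyInverseˡ (pointsOn ℓ) (P , P∈ℓ))

  pointAt-injective : ∀ ℓ → Injective _≡_ _≡_ (pointAt ℓ)
  pointAt-injective ℓ {k} {k′} e = begin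
    k              ≡⟨ strictlyInverseʳ k ⟨
    from (to k)    ≡⟨ cong from (Σ-T-≡ e) ⟩
    from (to k′)   ≡⟨ strictlyInverseʳ k′ ⟩
    k′             ∎
    where
    open ≡-Reasoning
    open Inverse (pointsOn ℓ)

-- What the counting needs of a projective plane of order q. Unlike the quadrangle axiom,
-- these axioms are self-dual.
record IsPlaneOfOrder (q : ℕ) (S : IncidenceStructure) : Set where
  open IncidenceStructure S
  field
    joinsAndMeets : JoinsAndMeets S
    pointsOn : ∀ ℓ → Fin (suc q) ↔ PointsOn ℓ
    linesThrough : ∀ P → Fin (suc q) ↔ Σ Line (P I_)
    antiflag : ∃[ O ] ∃[ ℓ ] ¬ O I ℓ

dual : ∀ {q S} → IsPlaneOfOrder q S → IsPlaneOfOrder q (dualStructure S)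
dual plane = record
  { joinsAndMeets = record { joinLine = meetPoint ; meetPoint = joinLine }
  ; pointsOn = linesThrough
  ; linesThrough = pointsOn
  ; antiflag = let O , ℓ , O∉ℓ = antiflag in ℓ , O , O∉ℓ
  }
  where
  open IsPlaneOfOrder plane
  open JoinsAndMeets joinsAndMeets

-- Every point other than O lies on exactly one spoke, a line joining O to a point
-- of ℓ₀, and each spoke has q points besides O: so there are 1 + (q + 1) q points.
module Enumeration {q S} (plane : IsPlaneOfOrder q S) where
  open IncidenceStructure S
  open IsPlaneOfOrder plane
  open JoinsAndMeets joinsAndMeets
  open Positions S pointsOn

  lineThrough : Point → Line
  lineThrough P = proj₁ (Inverse.to (linesThrough P) zero)

  lineThrough-I : ∀ P → P I lineThrough P
  lineThrough-I P = proj₂ (Inverse.to (linesThrough P) zero)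

  _≟ₚ_ : DecidableEquality Point
  P ≟ₚ Q with T? (inc Q (lineThrough P))
  ... | no Q∉ℓ = no λ P≡Q → Q∉ℓ (subst (_I lineThrough P) P≡Q (lineThrough-I P))
  ... | yes Q∈ℓ = map′
    (λ e → trans (sym (pointAt-position P∈ℓ)) (trans (cong (pointAt _) e) (pointAt-position Q∈ℓ)))
    (λ { refl → cong position (T-irrelevant P∈ℓ Q∈ℓ) })
    (position P∈ℓ ≟ᶠ position Q∈ℓ)
    where P∈ℓ = lineThrough-I P

  private
    O : Point
    O = proj₁ antiflag

    ℓ₀ : Line
    ℓ₀ = proj₁ (proj₂ antiflag)

    O∉ℓ₀ : ¬ O I ℓ₀
    O∉ℓ₀ = proj₂ (proj₂ antiflag)

  O≢pointAt : ∀ a → O ≢ pointAt ℓ₀ a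
  O≢pointAt a = ≢-sym (P∈ℓ∧Q∉ℓ⇒P≢Q (pointAt-I ℓ₀ a) O∉ℓ₀)

  spoke : Fin (suc q) → Line
  spoke a = join O (pointAt ℓ₀ a) (O≢pointAt a)

  spoke≢ℓ₀ : ∀ a → spoke a ≢ ℓ₀
  spoke≢ℓ₀ a = P∈ℓ∧P∉m⇒ℓ≢m (join-I₁ (O≢pointAt a)) O∉ℓ₀

  centre : Fin (suc q) → Fin (suc q)
  centre a = position (join-I₁ (O≢pointAt a))

  spokePoint : Fin (suc q) → Fin q → Point
  spokePoint a b = pointAt (spoke a) (punchIn (centre a) b)

  spokePoint≢O : ∀ a b → spokePoint a b ≢ O
  spokePoint≢O a b e =
    punchInᵢ≢i (centre a) b (pointAt-injective (spoke a) (trans e (sym (pointAt-position _))))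

  spoke-through : ∀ {P} → P ≢ O → ∃[ a ] P I spoke a
  spoke-through {P} P≢O = a , subst (P I_) (sym spoke≡ℓ) (join-I₂ O≢P)
    where
    O≢P = ≢-sym P≢O
    ℓ = join O P O≢P
    R∈ℓ₀ = meet-I₂ (P∈ℓ∧P∉m⇒ℓ≢m (join-I₁ O≢P) O∉ℓ₀)
    a = position R∈ℓ₀

    spoke≡ℓ : spoke a ≡ ℓ
    spoke≡ℓ = line-unique (O≢pointAt a) (join-I₁ _) (join-I₂ _)
      (join-I₁ O≢P) (subst (_I ℓ) (sym (pointAt-position R∈ℓ₀)) (meet-I₁ _))

  centre≢position : ∀ {P} a → P ≢ O → (P∈spoke : P I spoke a) → centre a ≢ position P∈spoke
  centre≢position {P} a P≢O P∈spoke e = P≢O (begin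
    P                                 ≡⟨ pointAt-position P∈spoke ⟨
    pointAt (spoke a) (position _)    ≡⟨ cong (pointAt (spoke a)) e ⟨
    pointAt (spoke a) (centre a)      ≡⟨ pointAt-position _ ⟩
    O                                 ∎)
    where open ≡-Reasoning

  Coordinates : Set
  Coordinates = ⊤ ⊎ (Fin (suc q) × Fin q)

  fromCoordinates : Coordinates → Point
  fromCoordinates (inj₁ _) = O
  fromCoordinates (inj₂ (a , b)) = spokePoint a b

  toCoordinates : Point → Coordinates
  toCoordinates P with P ≟ₚ O
  ... | yes _ = inj₁ tt
  ... | no P≢O = let a , P∈spoke = spoke-through P≢O in
                 inj₂ (a , punchOut (centre≢position a P≢O P∈spoke))

  fromCoordinates-toCoordinates : ∀ P → fromCoordinates (toCoordinates P) ≡ P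
  fromCoordinates-toCoordinates P with P ≟ₚ O
  ... | yes P≡O = sym P≡O
  ... | no P≢O = let a , P∈spoke = spoke-through P≢O in
    trans (cong (pointAt (spoke a)) (punchIn-punchOut (centre≢position a P≢O P∈spoke)))
          (pointAt-position P∈spoke)

  spokePoint-spoke : ∀ {a b a′ b′} → spokePoint a b ≡ spokePoint a′ b′ → a ≡ a′
  spokePoint-spoke {a} {b} {a′} e = pointAt-injective ℓ₀
    (point-unique (spoke≢ℓ₀ a) (join-I₂ _) (pointAt-I ℓ₀ a)
      (subst (pointAt ℓ₀ a′ I_) (sym spoke≡) (join-I₂ _)) (pointAt-I ℓ₀ a′))
    where
    spoke≡ : spoke a ≡ spoke a′
    spoke≡ = line-unique (≢-sym (spokePoint≢O a b)) (join-I₁ _) (pointAt-I _ _)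
      (join-I₁ _) (subst (_I spoke a′) (sym e) (pointAt-I _ _))

  spokePoint-injective : ∀ {a b a′ b′} → spokePoint a b ≡ spokePoint a′ b′ → (a , b) ≡ (a′ , b′)
  spokePoint-injective {a} {b} {a′} {b′} e with spokePoint-spoke e
  ... | refl = cong (a ,_) (punchIn-injective (centre a) b b′ (pointAt-injective (spoke a) e))

  fromCoordinates-injective : Injective _≡_ _≡_ fromCoordinates
  fromCoordinates-injective {inj₁ _} {inj₁ _} _ = refl
  fromCoordinates-injective {inj₁ _} {inj₂ (a , b)} e = contradiction (sym e) (spokePoint≢O a b)
  fromCoordinates-injective {inj₂ (a , b)} {inj₁ _} e = contradiction e (spokePoint≢O a b)
  fromCoordinates-injective {inj₂ _} {inj₂ _} e = cong inj₂ (spokePoint-injective e)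

  coordinates↔ : Coordinates ↔ Point
  coordinates↔ = mk↔ₛ′ fromCoordinates toCoordinates fromCoordinates-toCoordinates
    (λ c → fromCoordinates-injective (fromCoordinates-toCoordinates (fromCoordinates c)))

  points↔ : Fin (q * q + q + 1) ↔ Point
  points↔ = subst (λ k → Fin k ↔ Point) 1+[1+q]q≡N
    (↔-trans +↔⊎ (↔-trans (1↔⊤ ⊎-↔ *↔×) coordinates↔))
    where
    1+[1+q]q≡N : 1 + suc q * q ≡ q * q + q + 1
    1+[1+q]q≡N = trans (+-comm 1 (suc q * q)) (cong (_+ 1) (+-comm q (q * q)))

module _ {q} (Π : ProjectivePlane q) where
  open IncidenceStructure (struct Π)
  open IsProjectivePlane (isPP Π)

  joinsAndMeets : JoinsAndMeets (struct Π)
  joinsAndMeets = record { joinLine = joinLine ; meetPoint = meetPoint }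

  open JoinsAndMeets joinsAndMeets

  private
    A B C : Point
    A = proj₁ quadrangle zero
    B = proj₁ quadrangle (suc zero)
    C = proj₁ quadrangle (suc (suc zero))

    noncollinear : ∀ {ℓ} → A I ℓ → B I ℓ → C I ℓ → ⊥
    noncollinear A∈ℓ B∈ℓ C∈ℓ =
      proj₂ (proj₂ quadrangle) zero (suc zero) (suc (suc zero)) (λ ()) (λ ()) (λ ()) (_ , A∈ℓ , B∈ℓ , C∈ℓ)

    quadrangle-≢ : ∀ {i j} → i ≢ j → proj₁ quadrangle i ≢ proj₁ quadrangle j
    quadrangle-≢ i≢j = i≢j ∘ proj₁ (proj₂ quadrangle)

    A≢B : A ≢ B
    A≢B = quadrangle-≢ (λ ())

    A≢C : A ≢ C
    A≢C = quadrangle-≢ (λ ())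

    B≢C : B ≢ C
    B≢C = quadrangle-≢ (λ ())

    AB AC BC : Line
    AB = join A B A≢B
    AC = join A C A≢C
    BC = join B C B≢C

    A∉BC : ¬ A I BC
    A∉BC A∈BC = noncollinear A∈BC (join-I₁ B≢C) (join-I₂ B≢C)

    AB≢AC : AB ≢ AC
    AB≢AC e = noncollinear (join-I₁ A≢B) (join-I₂ A≢B) (subst (C I_) (sym e) (join-I₂ A≢C))

  lineAvoiding : ∀ P → ∃[ ℓ ] ¬ P I ℓ
  lineAvoiding P with T? (inc P AB) | T? (inc P AC)
  ... | no P∉AB | _ = AB , P∉AB
  ... | yes _ | no P∉AC = AC , P∉AC
  ... | yes P∈AB | yes P∈AC = BC , λ P∈BC → A∉BC (subst (_I BC) P≡A P∈BC)
    where P≡A = point-unique AB≢AC P∈AB P∈AC (join-I₁ A≢B) (join-I₁ A≢C)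

  isPlaneOfOrder : IsPlaneOfOrder q (struct Π)
  isPlaneOfOrder = record
    { joinsAndMeets = joinsAndMeets
    ; pointsOn = order Π
    ; linesThrough = λ P → ↔-trans (order Π _) (pencil↔ (proj₂ (lineAvoiding P)))
    ; antiflag = A , BC , A∉BC
    }

module Covers {q} (Π : ProjectivePlane q) where
  open IncidenceStructure (struct Π)
  open JoinsAndMeets (joinsAndMeets Π)
  open Positions (struct Π) (order Π)
  private
    module Pencil = Positions (dualStructure (struct Π)) (IsPlaneOfOrder.linesThrough (isPlaneOfOrder Π))

  N : ℕ
  N = q * q + q + 1

  -- Opaque: unfolding the enumerations during unification makes type checking very slow.
  private opaque
    points↔ : Fin N ↔ Point
    points↔ = Enumeration.points↔ (isPlaneOfOrder Π)

    lines↔ : Fin N ↔ Line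
    lines↔ = Enumeration.points↔ (dual (isPlaneOfOrder Π))

  point : Fin N → Point
  point = Inverse.to points↔

  pointIndex : Point → Fin N
  pointIndex = Inverse.from points↔

  line : Fin N → Line
  line = Inverse.to lines↔

  lineIndex : Line → Fin N
  lineIndex = Inverse.from lines↔

  point-pointIndex : ∀ P → point (pointIndex P) ≡ P
  point-pointIndex = Inverse.strictlyInverseˡ points↔

  pointIndex-point : ∀ i → pointIndex (point i) ≡ i
  pointIndex-point = Inverse.strictlyInverseʳ points↔

  line-lineIndex : ∀ ℓ → line (lineIndex ℓ) ≡ ℓ
  line-lineIndex = Inverse.strictlyInverseˡ lines↔

  lineIndex-line : ∀ j → lineIndex (line j) ≡ j
  lineIndex-line = Inverse.strictlyInverseʳ lines↔

  point-injective : Injective _≡_ _≡_ point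
  point-injective = Injection.injective (↔⇒↣ points↔)

  pointIndex-injective : Injective _≡_ _≡_ pointIndex
  pointIndex-injective = Injection.injective (↔⇒↣ (↔-sym points↔))

  line-injective : Injective _≡_ _≡_ line
  line-injective = Injection.injective (↔⇒↣ lines↔)

  lineIndex-injective : Injective _≡_ _≡_ lineIndex
  lineIndex-injective = Injection.injective (↔⇒↣ (↔-sym lines↔))

  module _ {t} (g : Fin t → Fin N) where

    unused : Fin (N ∸ t) → Fin N
    unused r = enum (∁ (image g)) (inject≤ r enough)
      where
      enough : N ∸ t ≤ ∣ ∁ (image g) ∣
      enough = ≤-trans (∸-monoʳ-≤ N (∣image∣≤ g)) (≤-reflexive (sym (∣∁p∣≡n∸∣p∣ (image g))))

    unused-∉ : ∀ r {s} → unused r ≢ g s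
    unused-∉ r {s} e = x∈∁p⇒x∉p (enum-∈ _ _) (subst (_∈ image g) (sym e) (∈-image⁺ g s))

    unused-injective : Injective _≡_ _≡_ unused
    unused-injective = inject≤-injective _ _ _ _ ∘ enum-injective _

  coverToNonIncident : ∀ {t} → ChamberCover Π t → NonIncidentPair Π (N ∸ t)
  coverToNonIncident {t} (c , covered) =
    X , Y , unused-injective usedPoints ∘ point-injective , unused-injective usedLines ∘ line-injective , X∉Y
    where
    usedPoints usedLines : Fin t → Fin N
    usedPoints i = pointIndex (proj₁ (proj₁ (c i)))
    usedLines i = lineIndex (proj₂ (proj₁ (c i)))

    X : Fin (N ∸ t) → Point
    X = point ∘ unused usedPoints

    Y : Fin (N ∸ t) → Line
    Y = line ∘ unused usedLines

    X∉Y : ∀ r s → ¬ X r I Y s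
    X∉Y r s X∈Y = [ unused-∉ usedPoints r ∘ (trans (sym (pointIndex-point _)) ∘ cong pointIndex)
                  , unused-∉ usedLines s ∘ (trans (sym (lineIndex-line _)) ∘ cong lineIndex)
                  ]′ (proj₂ (covered ((X r , Y s) , X∈Y)))

  module FromNonIncidentPair {t} (t≤N : t ≤ N)
    {X : Fin (N ∸ t) → Point} {Y : Fin (N ∸ t) → Line}
    (X-injective : Injective _≡_ _≡_ X) (Y-injective : Injective _≡_ _≡_ Y)
    (X∉Y : ∀ r s → ¬ X r I Y s) where

    L R : Subset N
    L = ∁ (image (pointIndex ∘ X))
    R = ∁ (image (lineIndex ∘ Y))

    ∣∁image∣≡t : ∀ (g : Fin (N ∸ t) → Fin N) → Injective _≡_ _≡_ g → ∣ ∁ (image g) ∣ ≡ t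
    ∣∁image∣≡t g g-injective = begin
      ∣ ∁ (image g) ∣       ≡⟨ ∣∁p∣≡n∸∣p∣ (image g) ⟩
      N ∸ ∣ image g ∣       ≡⟨ cong (N ∸_) (∣image∣≡ g g-injective) ⟩
      N ∸ (N ∸ t)           ≡⟨ m∸[m∸n]≡n t≤N ⟩
      t                     ∎
      where open ≡-Reasoning

    ∣L∣≡t : ∣ L ∣ ≡ t
    ∣L∣≡t = ∣∁image∣≡t _ (X-injective ∘ pointIndex-injective)

    ∣R∣≡t : ∣ R ∣ ≡ t
    ∣R∣≡t = ∣∁image∣≡t _ (Y-injective ∘ lineIndex-injective)

    L⇒≢X : ∀ {i} r → i ∈ L → point i ≢ X r
    L⇒≢X {i} r i∈L e = x∈∁p⇒x∉p i∈L
      (subst (_∈ image (pointIndex ∘ X)) (trans (cong pointIndex (sym e)) (pointIndex-point i)) (∈-image⁺ _ r))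

    ∉L⇒X : ∀ {P} → pointIndex P ∉ L → ∃[ r ] X r ≡ P
    ∉L⇒X P∉L = map₂ pointIndex-injective (∈-image⁻ _ (x∉∁p⇒x∈p P∉L))

    ∉R⇒Y : ∀ {ℓ} → lineIndex ℓ ∉ R → ∃[ r ] Y r ≡ ℓ
    ∉R⇒Y ℓ∉R = map₂ lineIndex-injective (∈-image⁻ _ (x∉∁p⇒x∈p ℓ∉R))

    X-I⇒R : ∀ {r ℓ} → X r I ℓ → lineIndex ℓ ∈ R
    X-I⇒R X∈ℓ = x∉p⇒x∈∁p λ ℓ∈Y → let s , e = ∈-image⁻ _ ℓ∈Y in
      X∉Y _ s (subst (X _ I_) (sym (lineIndex-injective e)) X∈ℓ)

    incident? : ∀ i j → Dec (point i I line j)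
    incident? i j = T? (inc (point i) (line j))

    open Hall incident?

    -- The flag map of the double count. It is injective because X r determines r, and
    -- then P is the meet of X r P with Y r.
    redirect : ∀ {i ℓ} → i ∈ L → point i I ℓ → Chamber
    redirect {i} {ℓ} i∈L i∈ℓ with lineIndex ℓ ∈? R
    ... | yes _ = (point i , ℓ) , i∈ℓ
    ... | no ℓ∉R = let r = proj₁ (∉R⇒Y ℓ∉R) in
                   (X r , join (X r) (point i) (≢-sym (L⇒≢X r i∈L))) , join-I₁ _

    redirect-∈ : ∀ {S i ℓ} (i∈L : i ∈ L) (i∈ℓ : point i I ℓ) → i ∈ S →
      lineIndex (proj₂ (proj₁ (redirect i∈L i∈ℓ))) ∈ neighbours S ∩ R
    redirect-∈ {i = i} {ℓ} i∈L i∈ℓ i∈S with lineIndex ℓ ∈? R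
    ... | yes ℓ∈R = x∈p∩q⁺ (∈-neighbours⁺ i∈S (subst (point i I_) (sym (line-lineIndex ℓ)) i∈ℓ) , ℓ∈R)
    ... | no ℓ∉R = x∈p∩q⁺
      (∈-neighbours⁺ i∈S (subst (point i I_) (sym (line-lineIndex _)) (join-I₂ _)) , X-I⇒R (join-I₁ _))

    redirect-injective : ∀ {i j ℓ m} (i∈L : i ∈ L) (j∈L : j ∈ L) (i∈ℓ : point i I ℓ) (j∈m : point j I m) →
      proj₁ (redirect i∈L i∈ℓ) ≡ proj₁ (redirect j∈L j∈m) → i ≡ j × ℓ ≡ m
    redirect-injective {i} {j} {ℓ} {m} i∈L j∈L i∈ℓ j∈m e with lineIndex ℓ ∈? R | lineIndex m ∈? R
    ... | yes _ | yes _ = point-injective (cong proj₁ e) , cong proj₂ e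
    ... | yes _ | no _ = contradiction (cong proj₁ e) (L⇒≢X _ i∈L)
    ... | no _ | yes _ = contradiction (sym (cong proj₁ e)) (L⇒≢X _ j∈L)
    ... | no ℓ∉R | no m∉R = point-injective Pi≡Pj , trans (sym Yr≡ℓ) Yr≡m
      where
      r = proj₁ (∉R⇒Y ℓ∉R)
      Yr≡ℓ = proj₂ (∉R⇒Y ℓ∉R)

      Yr≡m : Y r ≡ m
      Yr≡m = trans (cong Y (X-injective (cong proj₁ e))) (proj₂ (∉R⇒Y m∉R))

      Pi≡Pj : point i ≡ point j
      Pi≡Pj = point-unique (P∈ℓ∧P∉m⇒ℓ≢m (join-I₁ _) (X∉Y r r))
        (join-I₂ _) (subst (point i I_) (sym Yr≡ℓ) i∈ℓ)
        (subst (point j I_) (sym (cong proj₂ e)) (join-I₂ _)) (subst (point j I_) (sym Yr≡m) j∈m)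

    hallCondition : HallCondition L R
    hallCondition {S} S⊆L =
      *-cancelʳ-≤ ∣ S ∣ ∣ neighbours S ∩ R ∣ (suc q) (injection⇒∣p∣*a≤∣q∣*b flag flag-∈ flag-injective)
      where
      redirected : ∀ i → i ∈ S → Fin (suc q) → Chamber
      redirected i i∈S c = redirect (S⊆L i∈S) (Pencil.pointAt-I (point i) c)

      flag : ∀ i → i ∈ S → Fin (suc q) → Fin N × Fin (suc q)
      flag i i∈S c = lineIndex (proj₂ (proj₁ (redirected i i∈S c))) , position (proj₂ (redirected i i∈S c))

      flag-∈ : ∀ {i} (i∈S : i ∈ S) c → proj₁ (flag i i∈S c) ∈ neighbours S ∩ R
      flag-∈ i∈S c = redirect-∈ (S⊆L i∈S) _ i∈S

      flag-injective : ∀ {i j} (i∈S : i ∈ S) (j∈S : j ∈ S) c d → flag i i∈S c ≡ flag j j∈S d → i ≡ j × c ≡ d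
      flag-injective {i} {j} i∈S j∈S c d e = i≡j , Pencil.pointAt-injective (point j)
          (trans (cong (λ k → Pencil.pointAt (point k) c) (sym i≡j)) lines≡)
        where
        ℓ≡ = lineIndex-injective (cong proj₁ e)
        P≡ = trans (sym (pointAt-position (proj₂ (redirected i i∈S c))))
               (trans (cong₂ pointAt ℓ≡ (cong proj₂ e)) (pointAt-position (proj₂ (redirected j j∈S d))))
        same = redirect-injective (S⊆L i∈S) (S⊆L j∈S) _ _ (×-≡,≡→≡ (P≡ , ℓ≡))
        i≡j = proj₁ same
        lines≡ = proj₂ same

    matching : Matching L R
    matching = hall hallCondition

    open Matching matching

    listed : Fin t → Fin N
    listed r = enum L (cast (sym ∣L∣≡t) r)

    listed-∈ : ∀ r → listed r ∈ L
    listed-∈ r = enum-∈ L _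

    listed-surjective : ∀ {i} → i ∈ L → ∃[ r ] listed r ≡ i
    listed-surjective i∈L =
      cast ∣L∣≡t (index i∈L) ,
      trans (cong (enum L) (cast-involutive (sym ∣L∣≡t) ∣L∣≡t (index i∈L))) (enum-index i∈L)

    chamber : Fin t → Chamber
    chamber r = (point (listed r) , line (mate (listed r) (listed-∈ r))) , mate-adjacent (listed-∈ r)

    point-covered : ∀ {P} → pointIndex P ∈ L → ∃[ r ] P ≡ proj₁ (proj₁ (chamber r))
    point-covered {P} P∈L =
      map₂ (λ e → trans (sym (point-pointIndex P)) (cong point (sym e))) (listed-surjective P∈L)

    mate-cong : ∀ {i j} → i ≡ j → (i∈L : i ∈ L) (j∈L : j ∈ L) → mate i i∈L ≡ mate j j∈L
    mate-cong refl _ _ = refl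

    line-covered : ∀ {ℓ} → lineIndex ℓ ∈ R → ∃[ r ] ℓ ≡ proj₂ (proj₁ (chamber r))
    line-covered {ℓ} ℓ∈R = r , (begin
      ℓ                                    ≡⟨ line-lineIndex ℓ ⟨
      line (lineIndex ℓ)                   ≡⟨ cong line mate≡ ⟨
      line (mate i i∈L)                    ≡⟨ cong line (mate-cong (sym listed≡) i∈L (listed-∈ r)) ⟩
      line (mate (listed r) (listed-∈ r))  ∎)
      where
      open ≡-Reasoning
      mated = mate-surjective (≤-reflexive (trans ∣R∣≡t (sym ∣L∣≡t))) matching ℓ∈R
      i = proj₁ mated
      i∈L = proj₁ (proj₂ mated)
      mate≡ = proj₂ (proj₂ mated)
      r = proj₁ (listed-surjective i∈L)
      listed≡ = proj₂ (listed-surjective i∈L)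

    covered : ∀ (x : Chamber) → ∃[ r ]
      (proj₁ (proj₁ x) ≡ proj₁ (proj₁ (chamber r)) ⊎ proj₂ (proj₁ x) ≡ proj₂ (proj₁ (chamber r)))
    covered ((P , ℓ) , P∈ℓ) = byCases (pointIndex P ∈? L)
      where
      byCases : Dec (pointIndex P ∈ L) → ∃[ r ] (P ≡ proj₁ (proj₁ (chamber r)) ⊎ ℓ ≡ proj₂ (proj₁ (chamber r)))
      byCases (yes P∈L) = map₂ inj₁ (point-covered P∈L)
      byCases (no P∉L) = map₂ inj₂ (line-covered (X-I⇒R (subst (_I ℓ) (sym (proj₂ (∉L⇒X P∉L))) P∈ℓ)))

  nonIncidentToCover : ∀ {t} → t ≤ N → NonIncidentPair Π (N ∸ t) → ChamberCover Π t
  nonIncidentToCover t≤N (X , Y , X-injective , Y-injective , X∉Y) = chamber , covered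
    where open FromNonIncidentPair t≤N X-injective Y-injective X∉Y

theorem2 : ∀ (q : ℕ) (Π : ProjectivePlane q) (t : ℕ) →
    t ≤ q * q + q + 1 →
    ChamberCover Π t ⇔ NonIncidentPair Π (q * q + q + 1 ∸ t)
theorem2 q Π t t≤N = mk⇔ coverToNonIncident (nonIncidentToCover t≤N)
  where open Covers Π
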